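{- Let $E=(d_1,\ldots,d_{m-1})$ be a valid ordered tuple, $d=d_1+\cdots+d_{m-1}$, and let $a_0<a_1<\cdots$ be the terms of $S_E$. For some positive integer $z$, let $R=\{a_0,\ldots,a_z\}$, $\max(R)=a_z$, and $c=a_{z+1}$. Suppose: (i) $c=1+d\max(R)-\sum_{k=2}^{m-1}d_k(m-k-1)$; (ii) for every integer $0\le r_1\le c-1$ and every integer $0\le j\le d-2$, there exist a subset $H_j\subseteq\{2,\ldots,m-1\}$ and $r_2,\ldots,r_m\in R$ such that $\sum_{k\in H_j}d_k=j$, $\sum_{k=1}^{m-1}d_kr_k=dr_m$, the values $r_k$ ($k\in H_j\cup\{m\}$) are pairwise distinct, and the values $r_k$ ($k\in\{2,\ldots,m-1\}\setminus H_j$) are pairwise distinct. Then every term of $S_E$ can be expressed in the form $c\sum_{i\ge0}t_i(d+1)^i+r$ with $t_i\in\{0,1\}$ for all $i$ (finitely many nonzero) and $r\in R$.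
   Context: An ordered tuple $E=(d_1,\ldots,d_{m-1})$ of positive integers is written in nondecreasing order; $d=d_1+\cdots+d_{m-1}$; $E$ is valid if $d_1=1$ and $d_l\le d_1+\cdots+d_{l-1}$ for every $2\le l\le m-1$. The sequence $S_E$ is defined greedily: $a_0=0$, and having chosen $a_0,\ldots,a_k$, $a_{k+1}$ is the least integer greater than $a_k$ such that there are no distinct $x_1,\ldots,x_m\in\{a_0,\ldots,a_{k+1}\}$ with $d_1x_1+\cdots+d_{m-1}x_{m-1}=dx_m$. -}

module Defs where

open import Data.Nat using (ℕ; zero; suc; _+_; _*_; _∸_; _≤_; _<_)
open import Data.Fin using (Fin; toℕ) renaming (zero to fzero; suc to fsuc; _≤_ to _≤ᶠ_)
open import Data.Bool using (Bool; true; false; if_then_else_)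
open import Data.List using (List; []; _∷_)
open import Data.Product using (Σ; ∃; _×_)
open import Data.Sum using (_⊎_)
open import Relation.Nullary using (¬_)
open import Relation.Binary.PropositionalEquality using (_≡_; _≢_)

∑ : ∀ {n} → (Fin n → ℕ) → ℕ
∑ {zero}  f = 0
∑ {suc n} f = f fzero + ∑ (λ i → f (fsuc i))

-- A tuple E = (d_1,…,d_{m-1}) with m - 1 = suc n, i.e. m = n + 2.
-- Index i : Fin (suc n) stands for d_{toℕ i + 1}.
Tuple : ℕ → Set
Tuple n = Fin (suc n) → ℕ

dsum : ∀ {n} → Tuple n → ℕ
dsum D = ∑ D

prefixSum : ∀ {n} → Tuple n → Fin (suc n) → ℕ
prefixSum D l = ∑ (λ i → if toℕ i Data.Nat.<ᵇ toℕ l then D i else 0)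
  where import Data.Nat

record Nondecreasing {n : ℕ} (D : Tuple n) : Set where
  field
    positive : ∀ i → 0 < D i
    mono     : ∀ i j → i ≤ᶠ j → D i ≤ D j

record Valid {n : ℕ} (D : Tuple n) : Set where
  field
    first : D fzero ≡ 1
    bound : ∀ (l : Fin (suc n)) → 0 < toℕ l → D l ≤ prefixSum D l

HasSol : ∀ {n} → Tuple n → (ℕ → Set) → Set
HasSol {n} D A =
  Σ (Fin (suc n) → ℕ) λ x → Σ ℕ λ y →
    (∀ i → A (x i)) × A y ×
    (∀ i i' → i ≢ i' → x i ≢ x i') × (∀ i → x i ≢ y) ×
    (∑ (λ i → D i * x i) ≡ dsum D * y)

Prefix : (ℕ → ℕ) → ℕ → ℕ → Set
Prefix a j v = ∃ λ i → i ≤ j × a i ≡ v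

-- a is the greedy sequence S_E (a_0 < a_1 < …): a_0 = 0, and a_{j+1} is the
-- least integer > a_j such that {a_0,…,a_{j+1}} contains no solution.
record IsS {n : ℕ} (D : Tuple n) (a : ℕ → ℕ) : Set where
  field
    start   : a 0 ≡ 0
    incr    : ∀ j → a j < a (suc j)
    free    : ∀ j → ¬ HasSol D (Prefix a (suc j))
    least   : ∀ j v → a j < v → v < a (suc j) →
              HasSol D (λ w → Prefix a j w ⊎ w ≡ v)

-- ∑_i t_i b^i for a finite 0/1 digit list t = (t_0, t_1, …)
digits : ℕ → List Bool → ℕ
digits b []      = 0
digits b (t ∷ ts) = (if t then 1 else 0) + b * digits b ts

module Submission where

-- By induction on k (Main.invariant): a 0, …, a k ∈ T, and every element of T up to
-- a k is among them.  Two facts drive the induction step.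
--  * T contains no solution (Main.T-free).  For a solution in T the equation splits as
--    c·∑ dᵢNᵢ + ∑ dᵢrᵢ = c·dN + d·r_m.  Equal numeral parts make the rᵢ a solution in R;
--    parts differing by one are excluded by the carry lemma (module Carry: in base d + 1
--    the Nᵢ must agree except at one index of weight 1) and the rearrangement
--    inequality, which contradict (i); a larger difference contradicts d·a z < 2c.
--    Hence greediness puts no element of T strictly between a k and a (k + 1).
--  * Writing a (k + 1) = c·Q + r₁, a base-b digit ≥ 2 of Q (Main.LargeDigit, built from
--    (ii)) or r₁ ∉ R (Main.foreign-remainder, built from greediness) would give a
--    solution among a 0, …, a (k + 1); hence a (k + 1) ∈ T.

open import Defs
open import Data.Nat.Properties
open import Algebra.Properties.Semiring.Sum +-*-semiring
  using (sum; sum-cong-≗; ∑-distrib-+; *-distribˡ-sum; sum-remove; sum-replicate-zero)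
open import Data.Nat
  using (ℕ; zero; suc; pred; _+_; _*_; _∸_; _≤_; _<_; _≤?_; _<?_; _≟_; _%_; _/_; z≤n; s≤s; >-nonZero; NonZero)
open import Data.Nat.DivMod using (m<n⇒m%n≡m; [m+kn]%n≡m%n; m≡m%n+[m/n]*n; m%n<n)
open import Data.Nat.Tactic.RingSolver using (solve-∀)
open import Data.Fin using (Fin; toℕ; punchIn; fromℕ<) renaming (zero to fzero; suc to fsuc)
import Data.Fin.Properties as Fin
open import Data.Bool using (Bool; true; false; if_then_else_; not)
import Data.Bool as Bool
open import Data.List using (List; []; _∷_; map; length)
open import Data.List.Properties using (map-id)
open import Data.List.Relation.Unary.All using (All; []; _∷_; universal)
open import Data.List.Relation.Unary.All.Properties using (map⁺; ¬All⇒Any¬)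
open import Data.List.Relation.Unary.Any using (Any; here; there)
import Data.List.Relation.Unary.Any as Any
import Data.List.Relation.Unary.All as All
open import Data.List.Membership.Propositional using (_∈_; find)
open import Data.Digit using (toDigits; fromDigits)
open import Data.Product using (Σ; _×_; _,_; proj₁; proj₂)
open import Data.Sum using (_⊎_; inj₁; inj₂)
import Data.Sum
open import Data.Empty using (⊥; ⊥-elim)
open import Function using (_∘_)
open import Relation.Nullary using (¬_; yes; no)
open import Relation.Nullary.Decidable using (fromWitness)
open import Relation.Binary.PropositionalEquality
open import Relation.Binary.Definitions using (tri<; tri≈; tri>)

∑≡sum : ∀ {n} (f : Fin n → ℕ) → ∑ f ≡ sum f
∑≡sum {zero} f = refl
∑≡sum {suc n} f = cong (f fzero +_) (∑≡sum (λ i → f (fsuc i)))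

∑-cong : ∀ {n} {f g : Fin n → ℕ} → (∀ i → f i ≡ g i) → ∑ f ≡ ∑ g
∑-cong {f = f} {g} f≗g = trans (∑≡sum f) (trans (sum-cong-≗ f≗g) (sym (∑≡sum g)))

∑-+ : ∀ {n} (f g : Fin n → ℕ) → ∑ (λ i → f i + g i) ≡ ∑ f + ∑ g
∑-+ f g = trans (∑≡sum (λ i → f i + g i)) (trans (∑-distrib-+ f g) (sym (cong₂ _+_ (∑≡sum f) (∑≡sum g))))

∑-* : ∀ {n} (k : ℕ) (f : Fin n → ℕ) → ∑ (λ i → k * f i) ≡ k * ∑ f
∑-* k f = trans (∑≡sum (λ i → k * f i)) (trans (sym (*-distribˡ-sum k f)) (cong (k *_) (sym (∑≡sum f))))

∑-zero : ∀ n → ∑ {n} (λ _ → 0) ≡ 0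
∑-zero n = trans (∑≡sum {n} (λ _ → 0)) (sum-replicate-zero n)

∑-punchIn : ∀ {n} (f : Fin (suc n) → ℕ) (p : Fin (suc n)) → ∑ f ≡ f p + ∑ (λ i → f (punchIn p i))
∑-punchIn f p =
  trans (∑≡sum f) (trans (sum-remove {i = p} f) (cong (f p +_) (sym (∑≡sum (λ i → f (punchIn p i))))))

∑-mono : ∀ {n} {f g : Fin n → ℕ} → (∀ i → f i ≤ g i) → ∑ f ≤ ∑ g
∑-mono {zero} f≤g = z≤n
∑-mono {suc n} f≤g = +-mono-≤ (f≤g fzero) (∑-mono (λ i → f≤g (fsuc i)))

∑-≥-term : ∀ {n} (f : Fin (suc n) → ℕ) i → f i ≤ ∑ f
∑-≥-term f i = ≤-trans (m≤m+n (f i) _) (≤-reflexive (sym (∑-punchIn f i)))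

Distinct : ∀ {n} → (Fin n → ℕ) → Set
Distinct v = ∀ i j → i ≢ j → v i ≢ v j

Monotone : ∀ {n} → (Fin n → ℕ) → Set
Monotone w = ∀ i j → toℕ i ≤ toℕ j → w i ≤ w j

distinct-punchIn : ∀ {n} (v : Fin (suc n) → ℕ) p → Distinct v → Distinct (λ i → v (punchIn p i))
distinct-punchIn v p v-distinct i j i≢j = v-distinct _ _ (i≢j ∘ Fin.punchIn-injective p i j)

punchIn-constant-prefix : ∀ {k} (w : Fin (suc k) → ℕ) p {u} → (∀ i → toℕ i ≤ toℕ p → w i ≡ u) →
  ∀ j → w (punchIn p j) ≡ w (fsuc j)
punchIn-constant-prefix w fzero _ j = refl
punchIn-constant-prefix {suc k} w (fsuc p) const fzero = trans (const fzero z≤n) (sym (const (fsuc fzero) (s≤s z≤n)))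
punchIn-constant-prefix {suc k} w (fsuc p) const (fsuc j) =
  punchIn-constant-prefix (w ∘ fsuc) p (λ i i≤p → const (fsuc i) (s≤s i≤p)) j

large-value : ∀ n (v : Fin (suc n) → ℕ) → Distinct v → Σ (Fin (suc n)) λ p → n ≤ v p
large-value n v v-distinct with Fin.any? (λ p → n ≤? v p)
... | yes found = found
... | no none with Fin.pigeonhole (n<1+n n) (λ p → fromℕ< (≰⇒> (λ n≤vp → none (p , n≤vp))))
... | i , j , i<j , same-image = ⊥-elim (v-distinct i j (λ i≡j → <⇒≢ i<j (cong toℕ i≡j))
        (trans (sym (Fin.toℕ-fromℕ< _)) (trans (cong toℕ same-image) (Fin.toℕ-fromℕ< _))))

staircase : (n : ℕ) → Fin n → ℕ
staircase n i = n ∸ suc (toℕ i)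

distinct-sum : ∀ n (v : Fin n → ℕ) → Distinct v → ∑ (staircase n) ≤ ∑ v
distinct-sum zero v _ = z≤n
distinct-sum (suc n) v v-distinct with large-value n v v-distinct
... | p , n≤vp = begin
    n + ∑ (staircase n)                 ≤⟨ +-mono-≤ n≤vp (distinct-sum n _ (distinct-punchIn v p v-distinct)) ⟩
    v p + ∑ (λ i → v (punchIn p i))     ≡⟨ sym (∑-punchIn v p) ⟩
    ∑ v                                 ∎
  where open ≤-Reasoning

rearrangement : ∀ n (w v : Fin n → ℕ) → Monotone w → Distinct v →
  ∑ (λ i → w i * staircase n i) ≤ ∑ (λ i → w i * v i)
rearrangement zero w v _ _ = z≤n
rearrangement (suc n) w v w-mono v-distinct = begin
    ∑ (λ i → w i * t i)
      ≡⟨ weights-split t ⟩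
    w₀ * ∑ t + ∑ (λ i → w' (fsuc i) * staircase n i)
      ≤⟨ +-mono-≤ (*-monoʳ-≤ w₀ (distinct-sum (suc n) v v-distinct))
                  (rearrangement n (w' ∘ fsuc) (v ∘ fsuc) w'-mono v'-distinct) ⟩
    w₀ * ∑ v + ∑ (λ i → w' (fsuc i) * v (fsuc i))
      ≡⟨ sym (weights-split v) ⟩
    ∑ (λ i → w i * v i) ∎
  where
  open ≤-Reasoning
  t : Fin (suc n) → ℕ
  t = staircase (suc n)
  -- Split each weight as w₀ + w' i, where w' vanishes at index 0.
  w₀ : ℕ
  w₀ = w fzero
  w' : Fin (suc n) → ℕ
  w' i = w i ∸ w₀
  w'-mono : Monotone (w' ∘ fsuc)
  w'-mono i j i≤j = ∸-monoˡ-≤ w₀ (w-mono (fsuc i) (fsuc j) (s≤s i≤j))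
  v'-distinct : Distinct (v ∘ fsuc)
  v'-distinct i j i≢j = v-distinct (fsuc i) (fsuc j) (i≢j ∘ Fin.suc-injective)
  weights-split : ∀ u → ∑ (λ i → w i * u i) ≡ w₀ * ∑ u + ∑ (λ i → w' (fsuc i) * u (fsuc i))
  weights-split u = begin-equality
    ∑ (λ i → w i * u i)
      ≡⟨ ∑-cong (λ i → trans (cong (_* u i) (sym (m+[n∸m]≡n (w-mono fzero i z≤n))))
                             (*-distribʳ-+ (u i) w₀ (w' i))) ⟩
    ∑ (λ i → w₀ * u i + w' i * u i)
      ≡⟨ ∑-+ (λ i → w₀ * u i) (λ i → w' i * u i) ⟩
    ∑ (λ i → w₀ * u i) + (w' fzero * u fzero + ∑ (λ i → w' (fsuc i) * u (fsuc i)))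
      ≡⟨ cong₂ _+_ (∑-* w₀ u) (cong (λ x → x * u fzero + ∑ (λ i → w' (fsuc i) * u (fsuc i)))
                                    (n∸n≡0 w₀)) ⟩
    w₀ * ∑ u + ∑ (λ i → w' (fsuc i) * u (fsuc i)) ∎

rearrangement-upper : ∀ n (w v : Fin n → ℕ) (M : ℕ) → Monotone w → Distinct v → (∀ i → v i ≤ M) →
  ∑ (λ i → w i * staircase n i) + ∑ (λ i → w i * v i) ≤ M * ∑ w
rearrangement-upper n w v M w-mono v-distinct v≤M = begin
    ∑ (λ i → w i * staircase n i) + ∑ (λ i → w i * v i)
      ≤⟨ +-monoˡ-≤ _ (rearrangement n w (λ i → M ∸ v i) w-mono reflected-distinct) ⟩
    ∑ (λ i → w i * (M ∸ v i)) + ∑ (λ i → w i * v i)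
      ≡⟨ sym (∑-+ (λ i → w i * (M ∸ v i)) (λ i → w i * v i)) ⟩
    ∑ (λ i → w i * (M ∸ v i) + w i * v i)
      ≡⟨ ∑-cong (λ i → trans (sym (*-distribˡ-+ (w i) (M ∸ v i) (v i)))
                             (trans (cong (w i *_) (m∸n+n≡m (v≤M i))) (*-comm (w i) M))) ⟩
    ∑ (λ i → M * w i)
      ≡⟨ ∑-* M w ⟩
    M * ∑ w ∎
  where
  open ≤-Reasoning
  reflected-distinct : Distinct (λ i → M ∸ v i)
  reflected-distinct i j i≢j e =
    v-distinct i j i≢j (trans (sym (m∸[m∸n]≡n (v≤M i))) (trans (cong (M ∸_) e) (m∸[m∸n]≡n (v≤M j))))

divmod-unique : ∀ {c r r' N N'} → r < c → r' < c → r + c * N ≡ r' + c * N' → r ≡ r' × N ≡ N'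
divmod-unique {c} {r} {r'} {N} {N'} r<c r'<c eq = r≡r' , N≡N'
  where
  instance
    c≢0 : NonZero c
    c≢0 = >-nonZero (≤-<-trans z≤n r<c)
  remainder : ∀ {s} K → s < c → (s + c * K) % c ≡ s
  remainder {s} K s<c =
    trans (cong (λ u → (s + u) % c) (*-comm c K)) (trans ([m+kn]%n≡m%n s K c) (m<n⇒m%n≡m s<c))
  r≡r' : r ≡ r'
  r≡r' = trans (sym (remainder N r<c)) (trans (cong (_% c) eq) (remainder N' r'<c))
  N≡N' : N ≡ N'
  N≡N' = *-cancelˡ-≡ N N' c (+-cancelˡ-≡ r' _ _ (trans (cong (_+ c * N) (sym r≡r')) eq))

bit : Bool → ℕ
bit x = if x then 1 else 0

bit-injective : ∀ x y → bit x ≡ bit y → x ≡ y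
bit-injective true true _ = refl
bit-injective false false _ = refl

bit≤1 : ∀ x → bit x ≤ 1
bit≤1 true = s≤s z≤n
bit≤1 false = z≤n

isPos : ℕ → Bool
isPos zero = false
isPos (suc _) = true

bit-isPos≤ : ∀ q → bit (isPos q) ≤ q
bit-isPos≤ zero = z≤n
bit-isPos≤ (suc q) = s≤s z≤n

numeral : ℕ → List ℕ → ℕ
numeral b [] = 0
numeral b (q ∷ qs) = q + b * numeral b qs

digits-numeral : ∀ {A : Set} b (f : A → Bool) xs → digits b (map f xs) ≡ numeral b (map (bit ∘ f) xs)
digits-numeral b f [] = refl
digits-numeral b f (x ∷ xs) = cong (λ v → bit (f x) + b * v) (digits-numeral b f xs)

digits-isPos : ∀ b qs → All (_≤ 1) qs → digits b (map isPos qs) ≡ numeral b qs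
digits-isPos b [] [] = refl
digits-isPos b (q ∷ qs) (q≤1 ∷ qs≤1) = cong₂ (λ u v → u + b * v) (bit-isPos q≤1) (digits-isPos b qs qs≤1)
  where
  bit-isPos : ∀ {q} → q ≤ 1 → bit (isPos q) ≡ q
  bit-isPos z≤n = refl
  bit-isPos (s≤s z≤n) = refl

numeral-mono : ∀ {A : Set} b (f g : A → ℕ) → (∀ x → f x ≤ g x) → ∀ xs →
  numeral b (map f xs) ≤ numeral b (map g xs)
numeral-mono b f g f≤g [] = z≤n
numeral-mono b f g f≤g (x ∷ xs) = +-mono-≤ (f≤g x) (*-monoʳ-≤ b (numeral-mono b f g f≤g xs))

numeral-strict : ∀ {A : Set} b .{{_ : NonZero b}} (f g : A → ℕ) → (∀ x → f x ≤ g x) → ∀ xs →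
  Any (λ x → f x < g x) xs → numeral b (map f xs) < numeral b (map g xs)
numeral-strict b f g f≤g (x ∷ xs) (here fx<gx) =
  +-mono-<-≤ fx<gx (*-monoʳ-≤ b (numeral-mono b f g f≤g xs))
numeral-strict b f g f≤g (x ∷ xs) (there later) =
  +-mono-≤-< (f≤g x) (*-monoʳ-< b (numeral-strict b f g f≤g xs later))

digits-distinct : ∀ {A : Set} b → 1 < b → (f g : A → Bool) → ∀ xs →
  Any (λ x → f x ≢ g x) xs → digits b (map f xs) ≢ digits b (map g xs)
digits-distinct b 1<b f g (x ∷ xs) differs eq with divmod-unique (≤-<-trans (bit≤1 (f x)) 1<b)
                                                                    (≤-<-trans (bit≤1 (g x)) 1<b) eq
digits-distinct b 1<b f g (x ∷ xs) (here fx≢gx) eq | low≡ , _ = fx≢gx (bit-injective (f x) (g x) low≡)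
digits-distinct b 1<b f g (x ∷ xs) (there later) eq | _ , high≡ = digits-distinct b 1<b f g xs later high≡

base-expansion : ∀ d → 1 ≤ d → ∀ Q → Σ (List ℕ) λ qs → All (_≤ d) qs × numeral (suc d) qs ≡ Q
base-expansion d 1≤d Q with toDigits (suc d) {fromWitness (s≤s 1≤d)} Q
... | ds , value = map toℕ ds , map⁺ (universal (λ q → ≤-pred (Fin.toℕ<n q)) ds) , trans (as-numeral ds) value
  where
  as-numeral : ∀ ds → numeral (suc d) (map toℕ ds) ≡ fromDigits ds
  as-numeral [] = refl
  as-numeral (q ∷ ds) = cong (toℕ q +_) (trans (cong (suc d *_) (as-numeral ds)) (*-comm (suc d) _))

low : List Bool → Bool
low [] = false
low (x ∷ _) = x

high : List Bool → List Bool
high [] = []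
high (_ ∷ xs) = xs

digits-low-high : ∀ b t → digits b t ≡ bit (low t) + b * digits b (high t)
digits-low-high b [] = sym (*-zeroʳ b)
digits-low-high b (x ∷ t) = refl

Positive : ∀ {m} → (Fin m → ℕ) → Set
Positive w = ∀ i → 0 < w i

Wt : ∀ {m} → (Fin m → ℕ) → (Fin m → Bool) → ℕ
Wt w β = ∑ (λ i → w i * bit (β i))

Wt-≤ : ∀ {m} (w : Fin m → ℕ) β → Wt w β ≤ ∑ w
Wt-≤ w β = ∑-mono (λ i → ≤-trans (*-monoʳ-≤ (w i) (bit≤1 (β i))) (≤-reflexive (*-identityʳ (w i))))

Wt-complement : ∀ {m} (w : Fin m → ℕ) β → Wt w β + Wt w (not ∘ β) ≡ ∑ w
Wt-complement w β = trans (sym (∑-+ (λ i → w i * bit (β i)) (λ i → w i * bit (not (β i)))))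
                          (∑-cong (λ i → split (w i) (β i)))
  where
  split : ∀ x y → x * bit y + x * bit (not y) ≡ x
  split x true = trans (cong₂ _+_ (*-identityʳ x) (*-zeroʳ x)) (+-identityʳ x)
  split x false = trans (cong (_+ x * 1) (*-zeroʳ x)) (*-identityʳ x)

Wt-none : ∀ {m} (w : Fin m → ℕ) → Positive w → ∀ β → Wt w β ≡ 0 → ∀ i → β i ≡ false
Wt-none {suc m} w pos β W≡0 i with β i | ∑-≥-term (λ j → w j * bit (β j)) i
... | false | _ = refl
... | true | term≤W =
  ⊥-elim (<⇒≱ (pos i) (≤-trans (≤-reflexive (sym (*-identityʳ (w i)))) (≤-trans term≤W (≤-reflexive W≡0))))

Wt-all : ∀ {m} (w : Fin m → ℕ) → Positive w → ∀ β → Wt w β ≡ ∑ w → ∀ i → β i ≡ true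
Wt-all w pos β W≡∑ i with β i | Wt-none w pos (not ∘ β) rest≡0 i
  where
  rest≡0 : Wt w (not ∘ β) ≡ 0
  rest≡0 = +-cancelˡ-≡ (Wt w β) _ _ (trans (Wt-complement w β) (trans (sym W≡∑) (sym (+-identityʳ _))))
... | true | _ = refl
... | false | ()

UnitExcept : ∀ {m} → (Fin m → ℕ) → (Fin m → Bool) → Bool → Set
UnitExcept {m} w β v = Σ (Fin m) λ p → w p ≡ 1 × (∀ i → i ≢ p → β i ≡ v)

Wt-one : ∀ {m} (w : Fin m → ℕ) → Positive w → ∀ β → Wt w β ≡ 1 → UnitExcept w β false
Wt-one {suc m} w pos β W≡1 with β fzero in β₀
... | true = fzero , w₀≡1 , others
  where
  w₀≡1 : w fzero ≡ 1
  w₀≡1 = ≤-antisym (subst (_≤ 1) (*-identityʳ (w fzero)) (subst (w fzero * 1 ≤_) W≡1 (m≤m+n _ _))) (pos fzero)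
  tail≡0 : Wt (w ∘ fsuc) (β ∘ fsuc) ≡ 0
  tail≡0 = +-cancelˡ-≡ 1 _ _
    (trans (cong (_+ Wt (w ∘ fsuc) (β ∘ fsuc)) (sym (trans (*-identityʳ (w fzero)) w₀≡1))) W≡1)
  others : ∀ i → i ≢ fzero → β i ≡ false
  others fzero i≢0 = ⊥-elim (i≢0 refl)
  others (fsuc i) _ = Wt-none (w ∘ fsuc) (pos ∘ fsuc) (β ∘ fsuc) tail≡0 i
... | false with Wt-one (w ∘ fsuc) (pos ∘ fsuc) (β ∘ fsuc)
                   (trans (cong (_+ Wt (w ∘ fsuc) (β ∘ fsuc)) (sym (*-zeroʳ (w fzero)))) W≡1)
... | p , wp≡1 , others = fsuc p , wp≡1 , others'
  where
  others' : ∀ i → i ≢ fsuc p → β i ≡ false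
  others' fzero _ = β₀
  others' (fsuc i) i≢p = others i (i≢p ∘ cong fsuc)

Wt-all-but-one : ∀ {m} (w : Fin m → ℕ) → Positive w → ∀ β → suc (Wt w β) ≡ ∑ w → UnitExcept w β true
Wt-all-but-one w pos β 1+W≡∑ with Wt-one w pos (not ∘ β) rest≡1
  where
  rest≡1 : Wt w (not ∘ β) ≡ 1
  rest≡1 = +-cancelˡ-≡ (Wt w β) _ _ (trans (Wt-complement w β) (trans (sym 1+W≡∑) (+-comm 1 _)))
... | p , wp≡1 , others = p , wp≡1 , λ i i≢p → not-false (others i i≢p)
  where
  not-false : ∀ {x} → not x ≡ false → x ≡ true
  not-false {true} _ = refl

-- Positive weights w with total d, and 0/1 numerals in base b = d + 1.  If
-- ∑ wᵢ·Nᵢ equals d·N exactly, all Nᵢ equal N; if it is off by one, all Nᵢ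
-- agree except at one index of weight 1.  Proof digit by digit: the low
-- digit of ∑ wᵢ·Nᵢ is a weighted selection ≤ d < b, so no carries occur.
module Carry {k : ℕ} (w : Fin (suc k) → ℕ) (pos : Positive w) where

  d : ℕ
  d = ∑ w

  b : ℕ
  b = suc d

  N : List Bool → ℕ
  N = digits b

  Asum : (Fin (suc k) → List Bool) → ℕ
  Asum t = ∑ (λ i → w i * N (t i))

  1≤d : 1 ≤ d
  1≤d = ≤-trans (pos fzero) (∑-≥-term w fzero)

  lows : (Fin (suc k) → List Bool) → Fin (suc k) → Bool
  lows t i = low (t i)

  highs : (Fin (suc k) → List Bool) → Fin (suc k) → List Bool
  highs t i = high (t i)

  Asum-split : ∀ t → Asum t ≡ Wt w (lows t) + b * Asum (highs t)
  Asum-split t = begin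
    ∑ (λ i → w i * N (t i))
      ≡⟨ ∑-cong (λ i → trans (cong (w i *_) (digits-low-high b (t i)))
                             (distribute (w i) (bit (low (t i))) b (N (high (t i))))) ⟩
    ∑ (λ i → w i * bit (low (t i)) + b * (w i * N (high (t i))))
      ≡⟨ ∑-+ (λ i → w i * bit (low (t i))) (λ i → b * (w i * N (high (t i)))) ⟩
    Wt w (lows t) + ∑ (λ i → b * (w i * N (high (t i))))
      ≡⟨ cong (Wt w (lows t) +_) (∑-* b (λ i → w i * N (high (t i)))) ⟩
    Wt w (lows t) + b * Asum (highs t) ∎
    where
    open ≡-Reasoning
    distribute : ∀ x y b z → x * (y + b * z) ≡ x * y + b * (x * z)
    distribute = solve-∀

  dN-split : ∀ tm → d * N tm ≡ d * bit (low tm) + b * (d * N (high tm))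
  dN-split tm = trans (cong (d *_) (digits-low-high b tm)) (distribute d (bit (low tm)) b (N (high tm)))
    where
    distribute : ∀ x y b z → x * (y + b * z) ≡ x * y + b * (x * z)
    distribute = solve-∀

  same-numeral : ∀ t t' → low t ≡ low t' → N (high t) ≡ N (high t') → N t ≡ N t'
  same-numeral t t' lo hi =
    trans (digits-low-high b t) (trans (cong₂ (λ x y → bit x + b * y) lo hi) (sym (digits-low-high b t')))

  AgreeExcept : (Fin (suc k) → List Bool) → Set
  AgreeExcept t = Σ (Fin (suc k)) λ p → w p ≡ 1 × (∀ i j → i ≢ p → j ≢ p → N (t i) ≡ N (t j))

  except-in-low : ∀ t v → UnitExcept w (lows t) v → (∀ i j → N (high (t i)) ≡ N (high (t j))) → AgreeExcept t
  except-in-low t v (p , wp≡1 , lo) hi =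
    p , wp≡1 , λ i j i≢p j≢p → same-numeral (t i) (t j) (trans (lo i i≢p) (sym (lo j j≢p))) (hi i j)

  except-in-high : ∀ t v → (∀ i → low (t i) ≡ v) → AgreeExcept (highs t) → AgreeExcept t
  except-in-high t v lo (p , wp≡1 , hi) =
    p , wp≡1 , λ i j i≢p j≢p → same-numeral (t i) (t j) (trans (lo i) (sym (lo j))) (hi i j i≢p j≢p)

  lows-agree : ∀ β h → Wt w β ≡ d * bit h → ∀ i → β i ≡ h
  lows-agree β true W≡d = Wt-all w pos β (trans W≡d (*-identityʳ d))
  lows-agree β false W≡0 = Wt-none w pos β (trans W≡0 (*-zeroʳ d))

  -- The induction is on a bound K for the lengths of all numerals involved.
  Fits : ℕ → (Fin (suc k) → List Bool) → List Bool → Set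
  Fits K t tm = (∀ i → length (t i) ≤ K) × length tm ≤ K

  length-high : ∀ {K} t → length t ≤ suc K → length (high t) ≤ K
  length-high [] _ = z≤n
  length-high (_ ∷ t) (s≤s len≤K) = len≤K

  fits-high : ∀ {K} t tm → Fits (suc K) t tm → Fits K (highs t) (high tm)
  fits-high t tm (t-fits , tm-fits) = (λ i → length-high (t i) (t-fits i)) , length-high tm tm-fits

  empty : ∀ t → length t ≤ 0 → N t ≡ 0
  empty [] _ = refl

  Asum-empty : ∀ t → (∀ i → length (t i) ≤ 0) → Asum t ≡ 0
  Asum-empty t t-fits =
    trans (∑-cong (λ i → trans (cong (w i *_) (empty (t i) (t-fits i))) (*-zeroʳ (w i)))) (∑-zero (suc k))

  -- Both low digits are below the base, so they can be compared by divmod-unique.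
  Wt<b : ∀ β → Wt w β < b
  Wt<b β = s≤s (Wt-≤ w β)

  d·bit<b : ∀ h → d * bit h < b
  d·bit<b h = s≤s (≤-trans (*-monoʳ-≤ d (bit≤1 h)) (≤-reflexive (*-identityʳ d)))

  balanced-fits : ∀ K t tm → Fits K t tm → Asum t ≡ d * N tm → ∀ i → N (t i) ≡ N tm
  balanced-fits zero t tm (t-fits , tm-fits) _ i = trans (empty (t i) (t-fits i)) (sym (empty tm tm-fits))
  balanced-fits (suc K) t tm fits eq i =
      same-numeral (t i) tm (lows-agree (lows t) (low tm) (proj₁ digit) i)
                   (balanced-fits K (highs t) (high tm) (fits-high t tm fits) (proj₂ digit) i)
    where
    digit : Wt w (lows t) ≡ d * bit (low tm) × Asum (highs t) ≡ d * N (high tm)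
    digit = divmod-unique (Wt<b (lows t)) (d·bit<b (low tm)) (trans (sym (Asum-split t)) (trans eq (dN-split tm)))

  excess-fits : ∀ K t tm → Fits K t tm → Asum t ≡ suc (d * N tm) → AgreeExcept t
  excess-fits zero t tm (t-fits , _) eq = ⊥-elim (0≢1+n (trans (sym (Asum-empty t t-fits)) eq))
  excess-fits (suc K) t tm fits eq with low tm in low≡
  ... | false = except-in-low t false (Wt-one w pos (lows t) (proj₁ digit)) (λ i j → trans (high≡ i) (sym (high≡ j)))
    where
    B : ℕ
    B = d * N (high tm)
    digit : Wt w (lows t) ≡ 1 × Asum (highs t) ≡ B
    digit = divmod-unique (Wt<b (lows t)) (s≤s 1≤d) (begin
      Wt w (lows t) + b * Asum (highs t) ≡⟨ sym (Asum-split t) ⟩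
      Asum t                            ≡⟨ eq ⟩
      suc (d * N tm)                    ≡⟨ cong suc (dN-split tm) ⟩
      suc (d * bit (low tm) + b * B)    ≡⟨ cong (λ x → suc (d * bit x + b * B)) low≡ ⟩
      suc (d * 0 + b * B)               ≡⟨ cong (λ x → suc (x + b * B)) (*-zeroʳ d) ⟩
      1 + b * B                         ∎)
      where open ≡-Reasoning
    high≡ : ∀ i → N (high (t i)) ≡ N (high tm)
    high≡ = balanced-fits K (highs t) (high tm) (fits-high t tm fits) (proj₂ digit)
  ... | true = except-in-high t false (Wt-none w pos (lows t) (proj₁ digit))
                 (excess-fits K (highs t) (high tm) (fits-high t tm fits) (proj₂ digit))
    where
    B : ℕ
    B = d * N (high tm)
    carry : ∀ d B → suc (d * 1 + suc d * B) ≡ 0 + suc d * suc B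
    carry = solve-∀
    digit : Wt w (lows t) ≡ 0 × Asum (highs t) ≡ suc B
    digit = divmod-unique (Wt<b (lows t)) (s≤s z≤n) (begin
      Wt w (lows t) + b * Asum (highs t) ≡⟨ sym (Asum-split t) ⟩
      Asum t                            ≡⟨ eq ⟩
      suc (d * N tm)                    ≡⟨ cong suc (dN-split tm) ⟩
      suc (d * bit (low tm) + b * B)    ≡⟨ cong (λ x → suc (d * bit x + b * B)) low≡ ⟩
      suc (d * 1 + b * B)               ≡⟨ carry d B ⟩
      0 + b * suc B                     ∎)
      where open ≡-Reasoning

  deficit-fits : ∀ K t tm → Fits K t tm → suc (Asum t) ≡ d * N tm → AgreeExcept t
  deficit-fits zero t tm (_ , tm-fits) eq =
    ⊥-elim (1+n≢0 (trans eq (trans (cong (d *_) (empty tm tm-fits)) (*-zeroʳ d))))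
  deficit-fits (suc K) t tm fits eq with Wt w (lows t) ≟ d
  ... | yes W≡d = except-in-high t true (Wt-all w pos (lows t) W≡d)
                    (deficit-fits K (highs t) (high tm) (fits-high t tm fits) (proj₂ digit))
    where
    A : ℕ
    A = Asum (highs t)
    carry : ∀ d A → 0 + suc d * suc A ≡ suc (d + suc d * A)
    carry = solve-∀
    digit : 0 ≡ d * bit (low tm) × suc A ≡ d * N (high tm)
    digit = divmod-unique (s≤s z≤n) (d·bit<b (low tm)) (begin
      0 + b * suc A              ≡⟨ carry d A ⟩
      suc (d + b * A)            ≡⟨ cong (λ x → suc (x + b * A)) (sym W≡d) ⟩
      suc (Wt w (lows t) + b * A) ≡⟨ cong suc (sym (Asum-split t)) ⟩
      suc (Asum t)               ≡⟨ eq ⟩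
      d * N tm                   ≡⟨ dN-split tm ⟩
      d * bit (low tm) + b * (d * N (high tm)) ∎)
      where open ≡-Reasoning
  ... | no W≢d = except-in-low t true (Wt-all-but-one w pos (lows t) (unit (low tm) (proj₁ digit)))
                   (λ i j → trans (high≡ i) (sym (high≡ j)))
    where
    digit : suc (Wt w (lows t)) ≡ d * bit (low tm) × Asum (highs t) ≡ d * N (high tm)
    digit = divmod-unique (s≤s (≤∧≢⇒< (Wt-≤ w (lows t)) W≢d)) (d·bit<b (low tm))
                          (trans (cong suc (sym (Asum-split t))) (trans eq (dN-split tm)))
    unit : ∀ h → suc (Wt w (lows t)) ≡ d * bit h → suc (Wt w (lows t)) ≡ d
    unit true e = trans e (*-identityʳ d)
    unit false e = ⊥-elim (1+n≢0 (trans e (*-zeroʳ d)))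
    high≡ : ∀ i → N (high (t i)) ≡ N (high tm)
    high≡ = balanced-fits K (highs t) (high tm) (fits-high t tm fits) (proj₂ digit)

  size : (Fin (suc k) → List Bool) → List Bool → ℕ
  size t tm = length tm + ∑ (λ i → length (t i))

  fits-size : ∀ t tm → Fits (size t tm) t tm
  fits-size t tm = (λ i → ≤-trans (∑-≥-term (λ j → length (t j)) i) (m≤n+m _ (length tm))) , m≤m+n (length tm) _

  balanced : ∀ t tm → Asum t ≡ d * N tm → ∀ i → N (t i) ≡ N tm
  balanced t tm = balanced-fits (size t tm) t tm (fits-size t tm)

  excess : ∀ t tm → Asum t ≡ suc (d * N tm) → AgreeExcept t
  excess t tm = excess-fits (size t tm) t tm (fits-size t tm)

  deficit : ∀ t tm → suc (Asum t) ≡ d * N tm → AgreeExcept t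
  deficit t tm = deficit-fits (size t tm) t tm (fits-size t tm)

HasSol-mono : ∀ {n} (D : Tuple n) {A B : ℕ → Set} → (∀ v → A v → B v) → HasSol D A → HasSol D B
HasSol-mono D A⊆B (x , y , x∈A , y∈A , x-distinct , x≢y , eq) =
  x , y , (λ i → A⊆B _ (x∈A i)) , A⊆B _ y∈A , x-distinct , x≢y , eq

-- Translating a solution by K gives a solution: the coefficients on both sides sum to d.
HasSol-shift : ∀ {n} (D : Tuple n) {A : ℕ → Set} K →
  HasSol D A → HasSol D (λ v → Σ ℕ λ u → A u × v ≡ K + u)
HasSol-shift D K (x , y , x∈A , y∈A , x-distinct , x≢y , eq) =
  (λ i → K + x i) , K + y , (λ i → x i , x∈A i , refl) , (y , y∈A , refl) ,
  (λ i j i≢j e → x-distinct i j i≢j (+-cancelˡ-≡ K _ _ e)) , (λ i e → x≢y i (+-cancelˡ-≡ K _ _ e)) , shifted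
  where
  open ≡-Reasoning
  distribute : ∀ D K x → D * (K + x) ≡ K * D + D * x
  distribute = solve-∀
  collect : ∀ K d y → K * d + d * y ≡ d * (K + y)
  collect = solve-∀
  shifted : ∑ (λ i → D i * (K + x i)) ≡ dsum D * (K + y)
  shifted = begin
    ∑ (λ i → D i * (K + x i))                 ≡⟨ ∑-cong (λ i → distribute (D i) K (x i)) ⟩
    ∑ (λ i → K * D i + D i * x i)             ≡⟨ ∑-+ (λ i → K * D i) (λ i → D i * x i) ⟩
    ∑ (λ i → K * D i) + ∑ (λ i → D i * x i)   ≡⟨ cong₂ _+_ (∑-* K D) eq ⟩
    K * dsum D + dsum D * y                   ≡⟨ collect K (dsum D) y ⟩
    dsum D * (K + y)                          ∎

module Greedy {n} (D : Tuple n) (a : ℕ → ℕ) (isS : IsS D a) where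
  open IsS isS

  a-mono : ∀ {i j} → i ≤ j → a i ≤ a j
  a-mono {j = zero} z≤n = ≤-refl
  a-mono {i} {suc j} i≤1+j with i ≟ suc j
  ... | yes refl = ≤-refl
  ... | no i≢1+j = ≤-trans (a-mono (≤-pred (≤∧≢⇒< i≤1+j i≢1+j))) (<⇒≤ (incr j))

  prefix-≤ : ∀ {j v} → Prefix a j v → v ≤ a j
  prefix-≤ (i , i≤j , refl) = a-mono i≤j

  prefix-weaken : ∀ {i j v} → i ≤ j → Prefix a i v → Prefix a j v
  prefix-weaken i≤j (l , l≤i , e) = l , ≤-trans l≤i i≤j , e

  locate : ∀ z' v → v < a (suc z') → Prefix a z' v ⊎ Σ ℕ λ j → j ≤ z' × a j < v × v < a (suc j)
  locate zero v v<a₁ with a 0 ≟ v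
  ... | yes a₀≡v = inj₁ (0 , z≤n , a₀≡v)
  ... | no a₀≢v = inj₂ (0 , z≤n , ≤∧≢⇒< (subst (_≤ v) (sym start) z≤n) a₀≢v , v<a₁)
  locate (suc z') v v<a with v <? a (suc z')
  ... | yes v<a' = Data.Sum.map (prefix-weaken (n≤1+n z'))
                                (λ (j , j≤z' , gap) → j , m≤n⇒m≤1+n j≤z' , gap) (locate z' v v<a')
  ... | no v≮a' with a (suc z') ≟ v
  ...   | yes a≡v = inj₁ (suc z' , ≤-refl , a≡v)
  ...   | no a≢v = inj₂ (suc z' , ≤-refl , ≤∧≢⇒< (≮⇒≥ v≮a') a≢v , v<a)

Covering : (n : ℕ) (D : Tuple n) (a : ℕ → ℕ) (z : ℕ) → Set
Covering n D a z = ∀ r1 → r1 < a (suc z) → ∀ j → j + 2 ≤ dsum D →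
  Σ (Fin n → Bool) λ H → Σ (Fin n → ℕ) λ r → Σ ℕ λ rm →
    (∀ i → Prefix a z (r i)) × Prefix a z rm ×
    (∑ (λ i → if H i then D (fsuc i) else 0) ≡ j) ×
    (D fzero * r1 + ∑ (λ i → D (fsuc i) * r i) ≡ dsum D * rm) ×
    (∀ i i' → H i ≡ true → H i' ≡ true → i ≢ i' → r i ≢ r i') ×
    (∀ i → H i ≡ true → r i ≢ rm) ×
    (∀ i i' → H i ≡ false → H i' ≡ false → i ≢ i' → r i ≢ r i')

module Main (n : ℕ) (D : Tuple n) (nd : Nondecreasing D) (valid : Valid D)
    (a : ℕ → ℕ) (isS : IsS D a) (z : ℕ) (0<z : 0 < z)
    (c-formula : a (suc z) + ∑ (λ (i : Fin n) → D (fsuc i) * (n ∸ suc (toℕ i))) ≡ 1 + dsum D * a z)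
    (covering : Covering n D a z) where

  open Greedy D a isS
  open Nondecreasing nd using (positive)

  d b c M : ℕ
  d = dsum D
  b = suc d
  c = a (suc z)
  M = a z

  w : Fin n → ℕ
  w i = D (fsuc i)

  e s : ℕ
  e = ∑ w
  s = ∑ (λ i → w i * staircase n i)

  d≡1+e : d ≡ 1 + e
  d≡1+e = cong (_+ e) (Valid.first valid)

  1≤d : 1 ≤ d
  1≤d = subst (1 ≤_) (sym d≡1+e) (s≤s z≤n)

  R : ℕ → Set
  R = Prefix a z

  M<c : M < c
  M<c = IsS.incr isS z

  R<c : ∀ {r} → R r → r < c
  R<c r∈R = ≤-<-trans (prefix-≤ r∈R) M<c

  R-free : ¬ HasSol D R
  R-free = subst (λ j → ¬ HasSol D (Prefix a j)) (suc-pred z) (IsS.free isS (pred z))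
    where
    instance
      z≢0 : NonZero z
      z≢0 = >-nonZero 0<z

  T : ℕ → Set
  T v = Σ (List Bool) λ t → Σ ℕ λ r → R r × v ≡ c * digits b t + r

  c·N+r-injective : ∀ N N' r r' → r < c → r' < c → c * N + r ≡ c * N' + r' → N ≡ N' × r ≡ r'
  c·N+r-injective N N' r r' r<c r'<c eq
    with divmod-unique r<c r'<c (trans (+-comm r (c * N)) (trans eq (+-comm (c * N') r')))
  ... | r≡r' , N≡N' = N≡N' , r≡r'

  w-mono : Monotone w
  w-mono i j i≤j = Nondecreasing.mono nd (fsuc i) (fsuc j) (s≤s i≤j)

  s≤ : ∀ v → Distinct v → s ≤ ∑ (λ i → w i * v i)
  s≤ v = rearrangement n w v w-mono

  s+≤Me : ∀ v → Distinct v → (∀ i → v i ≤ M) → s + ∑ (λ i → w i * v i) ≤ M * e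
  s+≤Me v = rearrangement-upper n w v M w-mono

  -- A weight-1 index is preceded only by weight-1 indices; removing it leaves d₂, …, d_{m-1}.
  remove-unit : ∀ p → D p ≡ 1 → ∀ (v : Fin (suc n) → ℕ) →
    ∑ (λ i → D i * v i) ≡ v p + ∑ (λ j → w j * v (punchIn p j))
  remove-unit p Dp≡1 v = begin
    ∑ (λ i → D i * v i)                                        ≡⟨ ∑-punchIn (λ i → D i * v i) p ⟩
    D p * v p + ∑ (λ j → D (punchIn p j) * v (punchIn p j))   ≡⟨ cong₂ _+_ unit shifted ⟩
    v p + ∑ (λ j → w j * v (punchIn p j))                      ∎
    where
    open ≡-Reasoning
    unit : D p * v p ≡ v p
    unit = trans (cong (_* v p) Dp≡1) (+-identityʳ (v p))
    ones : ∀ i → toℕ i ≤ toℕ p → D i ≡ 1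
    ones i i≤p = ≤-antisym (subst (D i ≤_) Dp≡1 (Nondecreasing.mono nd i p i≤p)) (positive i)
    shifted : ∑ (λ j → D (punchIn p j) * v (punchIn p j)) ≡ ∑ (λ j → w j * v (punchIn p j))
    shifted = ∑-cong (λ j → cong (_* v (punchIn p j)) (punchIn-constant-prefix D p ones j))

  -- Hypothesis (ii) states the weight of H as a sum of conditionals.
  weight-as-Wt : ∀ (H : Fin n → Bool) → ∑ (λ i → if H i then w i else 0) ≡ Wt w H
  weight-as-Wt H = ∑-cong (λ i → as-product (H i) (w i))
    where
    as-product : ∀ h x → (if h then x else 0) ≡ x * bit h
    as-product true x = sym (*-identityʳ x)
    as-product false x = sym (*-zeroʳ x)

  record CoverData (r1 j : ℕ) : Set where
    field
      H : Fin n → Bool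
      r : Fin n → ℕ
      rm : ℕ
      r∈R : ∀ i → R (r i)
      rm∈R : R rm
      weight : Wt w H ≡ j
      equation : D fzero * r1 + ∑ (λ i → w i * r i) ≡ d * rm
      distinct-in : ∀ i i' → H i ≡ true → H i' ≡ true → i ≢ i' → r i ≢ r i'
      distinct-rm : ∀ i → H i ≡ true → r i ≢ rm
      distinct-out : ∀ i i' → H i ≡ false → H i' ≡ false → i ≢ i' → r i ≢ r i'

  cover : ∀ r1 → r1 < c → ∀ j → j + 2 ≤ d → CoverData r1 j
  cover r1 r1<c j j+2≤d with covering r1 r1<c j j+2≤d
  ... | H , r , rm , r∈R , rm∈R , weight , equation , distinct-in , distinct-rm , distinct-out = record
    { H = H ; r = r ; rm = rm ; r∈R = r∈R ; rm∈R = rm∈R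
    ; weight = trans (sym (weight-as-Wt H)) weight ; equation = equation
    ; distinct-in = distinct-in ; distinct-rm = distinct-rm ; distinct-out = distinct-out }

  -- (i) together with (ii) for r₁ = 0, j = 0 gives d·M < 2c.
  d·M<c+c : d * M < c + c
  d·M<c+c with 2 ≤? d
  ... | no d≱2 = begin-strict
      d * M      <⟨ n<1+n (d * M) ⟩
      1 + d * M  ≡⟨ sym c-formula ⟩
      c + s      ≡⟨ cong (c +_) s≡0 ⟩
      c + 0      ≤⟨ +-monoʳ-≤ c z≤n ⟩
      c + c      ∎
    where
    open ≤-Reasoning
    e≡0 : e ≡ 0
    e≡0 = n≤0⇒n≡0 (≤-pred (subst (_≤ 1) d≡1+e (≤-pred (≰⇒> d≱2))))
    s≡0 : s ≡ 0
    s≡0 = n≤0⇒n≡0 (begin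
      s                     ≤⟨ ∑-mono (λ i → *-monoʳ-≤ (w i) (m∸n≤m n (suc (toℕ i)))) ⟩
      ∑ (λ i → w i * n)     ≡⟨ ∑-cong (λ i → *-comm (w i) n) ⟩
      ∑ (λ i → n * w i)     ≡⟨ ∑-* n w ⟩
      n * e                 ≡⟨ cong (n *_) e≡0 ⟩
      n * 0                 ≡⟨ *-zeroʳ n ⟩
      0                     ∎)
  ... | yes 2≤d = +-cancelˡ-< (s + s) _ _ (begin-strict
      (s + s) + d * M         ≤⟨ +-monoˡ-≤ (d * M) 2s≤dM ⟩
      d * M + d * M           <⟨ n<1+n _ ⟩
      suc (d * M + d * M)     ≤⟨ n≤1+n _ ⟩
      2 + d * M + d * M       ≡⟨ double-formula ⟩
      (s + s) + (c + c)       ∎)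
    where
    open ≤-Reasoning
    open CoverData (cover 0 (≤-<-trans z≤n M<c) 0 2≤d)
    H-empty : ∀ i → H i ≡ false
    H-empty = Wt-none w (positive ∘ fsuc) H weight
    r-distinct : Distinct r
    r-distinct i j = distinct-out i j (H-empty i) (H-empty j)
    2s≤dM : s + s ≤ d * M
    2s≤dM = begin
      s + s                       ≤⟨ +-monoʳ-≤ s (s≤ r r-distinct) ⟩
      s + ∑ (λ i → w i * r i)     ≤⟨ s+≤Me r r-distinct (λ i → prefix-≤ (r∈R i)) ⟩
      M * e                       ≤⟨ *-monoʳ-≤ M (m≤n+m e 1) ⟩
      M * (1 + e)                 ≡⟨ cong (M *_) (sym d≡1+e) ⟩
      M * d                       ≡⟨ *-comm M d ⟩
      d * M                       ∎
    rearrange : ∀ c s x → c + s ≡ 1 + x → 2 + x + x ≡ (s + s) + (c + c)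
    rearrange c s x cs = trans (halves x) (trans (cong₂ _+_ (sym cs) (sym cs)) (regroup c s))
      where
      halves : ∀ x → 2 + x + x ≡ (1 + x) + (1 + x)
      halves = solve-∀
      regroup : ∀ c s → (c + s) + (c + s) ≡ (s + s) + (c + c)
      regroup = solve-∀
    double-formula : 2 + d * M + d * M ≡ (s + s) + (c + c)
    double-formula = rearrange c s (d * M) c-formula

  -- T contains no solution: writing xᵢ = c·Nᵢ + rᵢ and y = c·N + r_m, the equation
  -- splits as c·∑ dᵢNᵢ + ∑ dᵢrᵢ = c·dN + d·r_m.  If ∑ dᵢNᵢ = dN the rᵢ solve it in R;
  -- if they differ by one, the carry lemma and the staircase bounds contradict (i);
  -- if they differ by more, 2c ≤ d·M.
  module SolutionInT (x : Fin (suc n) → ℕ) (y : ℕ) (x∈T : ∀ i → T (x i)) (y∈T : T y)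
                     (x-distinct : Distinct x) (x≢y : ∀ i → x i ≢ y)
                     (eq : ∑ (λ i → D i * x i) ≡ d * y) where
    open Carry D positive using (N; Asum; AgreeExcept; balanced; excess; deficit)

    t : Fin (suc n) → List Bool
    t i = proj₁ (x∈T i)

    r : Fin (suc n) → ℕ
    r i = proj₁ (proj₂ (x∈T i))

    r∈R : ∀ i → R (r i)
    r∈R i = proj₁ (proj₂ (proj₂ (x∈T i)))

    x≡ : ∀ i → x i ≡ c * N (t i) + r i
    x≡ i = proj₂ (proj₂ (proj₂ (x∈T i)))

    tm : List Bool
    tm = proj₁ y∈T

    rm : ℕ
    rm = proj₁ (proj₂ y∈T)

    rm∈R : R rm
    rm∈R = proj₁ (proj₂ (proj₂ y∈T))

    y≡ : y ≡ c * N tm + rm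
    y≡ = proj₂ (proj₂ (proj₂ y∈T))

    A B Rs : ℕ
    A = Asum t
    B = d * N tm
    Rs = ∑ (λ i → D i * r i)

    split : c * A + Rs ≡ c * B + d * rm
    split = begin
      c * A + Rs                                      ≡⟨ cong (_+ Rs) (sym (∑-* c (λ i → D i * N (t i)))) ⟩
      ∑ (λ i → c * (D i * N (t i))) + Rs
        ≡⟨ sym (∑-+ (λ i → c * (D i * N (t i))) (λ i → D i * r i)) ⟩
      ∑ (λ i → c * (D i * N (t i)) + D i * r i)
        ≡⟨ ∑-cong (λ i → trans (factor c (D i) (N (t i)) (r i)) (cong (D i *_) (sym (x≡ i)))) ⟩
      ∑ (λ i → D i * x i)                             ≡⟨ eq ⟩
      d * y                                           ≡⟨ cong (d *_) y≡ ⟩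
      d * (c * N tm + rm)                             ≡⟨ expand d c (N tm) rm ⟩
      c * B + d * rm                                  ∎
      where
      open ≡-Reasoning
      factor : ∀ c D N r → c * (D * N) + D * r ≡ D * (c * N + r)
      factor = solve-∀
      expand : ∀ d c N r → d * (c * N + r) ≡ c * (d * N) + d * r
      expand = solve-∀

    same-x : ∀ i j → N (t i) ≡ N (t j) → r i ≡ r j → x i ≡ x j
    same-x i j N≡ r≡ = trans (x≡ i) (trans (cong₂ (λ u v → c * u + v) N≡ r≡) (sym (x≡ j)))

    same-y : ∀ i → N (t i) ≡ N tm → r i ≡ rm → x i ≡ y
    same-y i N≡ r≡ = trans (x≡ i) (trans (cong₂ (λ u v → c * u + v) N≡ r≡) (sym y≡))

    -- Equal numerals: the remainders form a solution inside R.
    not-balanced : A ≢ B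
    not-balanced A≡B = R-free (r , rm , r∈R , rm∈R , r-distinct , r≢rm , Rs≡)
      where
      N≡ : ∀ i → N (t i) ≡ N tm
      N≡ = balanced t tm A≡B
      r-distinct : Distinct r
      r-distinct i j i≢j r≡ = x-distinct i j i≢j (same-x i j (trans (N≡ i) (sym (N≡ j))) r≡)
      r≢rm : ∀ i → r i ≢ rm
      r≢rm i r≡ = x≢y i (same-y i (N≡ i) r≡)
      Rs≡ : Rs ≡ d * rm
      Rs≡ = +-cancelˡ-≡ (c * A) _ _ (trans split (cong (λ u → c * u + d * rm) (sym A≡B)))

    -- Off by one: away from the exceptional index p the remainders are distinct,
    -- so the staircase bounds apply, and (i) says c + s = 1 + d·M.
    V : Fin (suc n) → ℕ
    V p = ∑ (λ j → w j * r (punchIn p j))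

    away-distinct : (agree : AgreeExcept t) → Distinct (λ j → r (punchIn (proj₁ agree) j))
    away-distinct (p , _ , N≡) j j' j≢j' r≡ =
      x-distinct (punchIn p j) (punchIn p j') (j≢j' ∘ Fin.punchIn-injective p j j')
        (same-x _ _ (N≡ _ _ (Fin.punchInᵢ≢i p j) (Fin.punchInᵢ≢i p j')) r≡)

    c+s≰dM : c + s ≤ d * M → ⊥
    c+s≰dM c+s≤dM = 1+n≰n (subst (_≤ d * M) c-formula c+s≤dM)

    rm-bound : d * rm ≤ d * M
    rm-bound = *-monoʳ-≤ d (prefix-≤ rm∈R)

    not-excess : A ≢ suc B
    not-excess A≡1+B with excess t tm A≡1+B
    ... | agree@(p , Dp≡1 , _) = c+s≰dM (begin
        c + s               ≤⟨ +-monoʳ-≤ c (≤-trans (s≤ _ (away-distinct agree)) (m≤n+m (V p) (r p))) ⟩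
        c + (r p + V p)     ≡⟨ cong (c +_) (sym (remove-unit p Dp≡1 r)) ⟩
        c + Rs              ≡⟨ c+Rs≡ ⟩
        d * rm              ≤⟨ rm-bound ⟩
        d * M               ∎)
      where
      open ≤-Reasoning
      carry : ∀ c B R → c * B + (c + R) ≡ c * suc B + R
      carry = solve-∀
      c+Rs≡ : c + Rs ≡ d * rm
      c+Rs≡ = +-cancelˡ-≡ (c * B) _ _ (trans (carry c B Rs) (trans (cong (λ u → c * u + Rs) (sym A≡1+B)) split))

    not-deficit : suc A ≢ B
    not-deficit 1+A≡B with deficit t tm 1+A≡B
    ... | agree@(p , Dp≡1 , _) = c+s≰dM (begin
        c + s                     ≤⟨ +-monoˡ-≤ s (m≤m+n c (d * rm)) ⟩
        c + d * rm + s            ≡⟨ cong (_+ s) (sym Rs≡) ⟩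
        Rs + s                    ≡⟨ cong (_+ s) (remove-unit p Dp≡1 r) ⟩
        r p + V p + s             ≡⟨ regroup (r p) (V p) s ⟩
        r p + (s + V p)           ≤⟨ +-mono-≤ (prefix-≤ (r∈R p))
                                               (s+≤Me _ (away-distinct agree) (λ j → prefix-≤ (r∈R (punchIn p j)))) ⟩
        M + M * e                 ≡⟨ collect M e ⟩
        (1 + e) * M               ≡⟨ cong (_* M) (sym d≡1+e) ⟩
        d * M                     ∎)
      where
      open ≤-Reasoning
      regroup : ∀ u v s → u + v + s ≡ u + (s + v)
      regroup = solve-∀
      collect : ∀ M e → M + M * e ≡ (1 + e) * M
      collect = solve-∀
      carry : ∀ c A X → c * suc A + X ≡ c * A + (c + X)
      carry = solve-∀
      Rs≡ : Rs ≡ c + d * rm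
      Rs≡ = +-cancelˡ-≡ (c * A) _ _
        (trans split (trans (cong (λ u → c * u + d * rm) (sym 1+A≡B)) (carry c A (d * rm))))

    -- Differing by two or more: 2c ≤ d·rm or 2c ≤ ∑ dᵢrᵢ, both ≤ d·M.
    2c≰dM : c + c ≤ d * M → ⊥
    2c≰dM = <⇒≱ d·M<c+c

    2c+ : ∀ c K → c * K + (c + c) ≡ c * suc (suc K)
    2c+ = solve-∀

    not-far-above : suc (suc B) ≤ A → ⊥
    not-far-above 2+B≤A = 2c≰dM (≤-trans (+-cancelˡ-≤ (c * B) _ _ (begin
        c * B + (c + c)       ≡⟨ 2c+ c B ⟩
        c * suc (suc B)       ≤⟨ *-monoʳ-≤ c 2+B≤A ⟩
        c * A                 ≤⟨ m≤m+n (c * A) Rs ⟩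
        c * A + Rs            ≡⟨ split ⟩
        c * B + d * rm        ∎)) rm-bound)
      where open ≤-Reasoning

    Rs-bound : Rs ≤ d * M
    Rs-bound = begin
      Rs                    ≤⟨ ∑-mono (λ i → *-monoʳ-≤ (D i) (prefix-≤ (r∈R i))) ⟩
      ∑ (λ i → D i * M)     ≡⟨ ∑-cong (λ i → *-comm (D i) M) ⟩
      ∑ (λ i → M * D i)     ≡⟨ ∑-* M D ⟩
      M * d                 ≡⟨ *-comm M d ⟩
      d * M                 ∎
      where open ≤-Reasoning

    not-far-below : suc (suc A) ≤ B → ⊥
    not-far-below 2+A≤B = 2c≰dM (≤-trans (+-cancelˡ-≤ (c * A) _ _ (begin
        c * A + (c + c)       ≡⟨ 2c+ c A ⟩
        c * suc (suc A)       ≤⟨ *-monoʳ-≤ c 2+A≤B ⟩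
        c * B                 ≤⟨ m≤m+n (c * B) (d * rm) ⟩
        c * B + d * rm        ≡⟨ sym split ⟩
        c * A + Rs            ∎)) Rs-bound)
      where open ≤-Reasoning

    impossible : ⊥
    impossible with <-cmp A B
    ... | tri≈ _ A≡B _ = not-balanced A≡B
    ... | tri< A<B _ _ with B ≟ suc A
    ...   | yes B≡1+A = not-deficit (sym B≡1+A)
    ...   | no B≢1+A = not-far-below (≤∧≢⇒< A<B (B≢1+A ∘ sym))
    impossible | tri> _ _ B<A with A ≟ suc B
    ...   | yes A≡1+B = not-excess A≡1+B
    ...   | no A≢1+B = not-far-above (≤∧≢⇒< B<A (A≢1+B ∘ sym))

  T-free : ¬ HasSol D T
  T-free (x , y , x∈T , y∈T , x-distinct , x≢y , eq) = SolutionInT.impossible x y x∈T y∈T x-distinct x≢y eq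

  c·N+r< : ∀ {N Q r r1} → N < Q → r < c → c * N + r < c * Q + r1
  c·N+r< {N} {Q} {r} {r1} N<Q r<c = begin-strict
    c * N + r       <⟨ +-monoʳ-< (c * N) r<c ⟩
    c * N + c       ≡⟨ trans (+-comm (c * N) c) (sym (*-suc c N)) ⟩
    c * suc N       ≤⟨ *-monoʳ-≤ c N<Q ⟩
    c * Q           ≤⟨ m≤m+n (c * Q) r1 ⟩
    c * Q + r1      ∎
    where open ≤-Reasoning

  -- Each digit q of Q is matched as q + (weight of a selection G_q of {2,…,m-1})
  -- = d·[q > 0]; at q₀ the selection is the H of hypothesis (ii) for j = d - q₀,
  -- whose r₂,…,r_m complete x to a solution made of x and elements of T below x.
  module LargeDigit (x r1 Q : ℕ) (r1<c : r1 < c) (x≡ : x ≡ c * Q + r1)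
                    (qs : List ℕ) (qs≤d : All (_≤ d) qs) (Q≡ : numeral b qs ≡ Q)
                    (q₀ : ℕ) (q₀∈qs : q₀ ∈ qs) (2≤q₀ : 2 ≤ q₀)
                    (P : ℕ → Set) (x∈P : P x) (T<x⊆P : ∀ v → T v → v < x → P v) where

    fits : ∀ {q} → 2 ≤ q → q ≤ d → (d ∸ q) + 2 ≤ d
    fits {q} 2≤q q≤d = ≤-trans (+-monoʳ-≤ (d ∸ q) 2≤q) (≤-reflexive (m∸n+n≡m q≤d))

    fits₀ : (d ∸ q₀) + 2 ≤ d
    fits₀ = fits 2≤q₀ (All.lookup qs≤d q₀∈qs)

    open CoverData (cover r1 r1<c (d ∸ q₀) fits₀)

    select : ℕ → Fin n → Bool
    select q with (d ∸ q) + 2 ≤? d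
    ... | yes fit = CoverData.H (cover r1 r1<c (d ∸ q) fit)
    ... | no _ = λ _ → isPos q

    select-q₀ : ∀ k → select q₀ k ≡ H k
    select-q₀ k with (d ∸ q₀) + 2 ≤? d
    ... | yes fit = cong (λ p → CoverData.H (cover r1 r1<c (d ∸ q₀) p) k) (≤-irrelevant fit fits₀)
    ... | no unfit = ⊥-elim (unfit fits₀)

    d+2≰d : ¬ (d ∸ 0) + 2 ≤ d
    d+2≰d = <⇒≱ (m<m+n d {2} (s≤s z≤n))

    select-0 : ∀ k → select 0 k ≡ false
    select-0 k with (d ∸ 0) + 2 ≤? d
    ... | yes fit = ⊥-elim (d+2≰d fit)
    ... | no _ = refl

    select-weight : ∀ q → q ≤ d → Wt w (select q) + q ≡ d * bit (isPos q)
    select-weight q q≤d with (d ∸ q) + 2 ≤? d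
    ... | yes fit = trans (cong (_+ q) (CoverData.weight (cover r1 r1<c (d ∸ q) fit)))
                           (trans (m∸n+n≡m q≤d) (sym (trans (cong (λ h → d * bit h) (large fit)) (*-identityʳ d))))
      where
      large : ∀ {q} → (d ∸ q) + 2 ≤ d → isPos q ≡ true
      large {zero} fit = ⊥-elim (d+2≰d fit)
      large {suc q} _ = refl
    ... | no unfit = small q q≤d unfit
      where
      small : ∀ q → q ≤ d → ¬ (d ∸ q) + 2 ≤ d → Wt w (λ _ → isPos q) + q ≡ d * bit (isPos q)
      small zero _ _ =
        trans (+-identityʳ _) (trans (∑-cong (λ i → *-zeroʳ (w i))) (trans (∑-zero n) (sym (*-zeroʳ d))))
      small (suc zero) _ _ =
        trans (cong (_+ 1) (∑-cong (λ i → *-identityʳ (w i))))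
              (trans (+-comm e 1) (trans (sym d≡1+e) (sym (*-identityʳ d))))
      small (suc (suc q)) q≤d unfit = ⊥-elim (unfit (fits (s≤s (s≤s z≤n)) q≤d))

    tk : Fin n → List Bool
    tk k = map (λ q → select q k) qs

    tM : List Bool
    tM = map isPos qs

    Nk : Fin n → ℕ
    Nk k = digits b (tk k)

    NM : ℕ
    NM = digits b tM

    digitwise : ∀ ls → All (_≤ d) ls →
      numeral b ls + ∑ (λ k → w k * digits b (map (λ q → select q k) ls)) ≡ d * digits b (map isPos ls)
    digitwise [] [] = trans (∑-cong (λ k → *-zeroʳ (w k))) (trans (∑-zero n) (sym (*-zeroʳ d)))
    digitwise (q ∷ ls) (q≤d ∷ ls≤d) = begin
        (q + b * V) + ∑ (λ k → w k * (bit (select q k) + b * N' k))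
          ≡⟨ cong ((q + b * V) +_) split ⟩
        (q + b * V) + (Wt w (select q) + b * S)
          ≡⟨ regroup q b V (Wt w (select q)) S ⟩
        (Wt w (select q) + q) + b * (V + S)
          ≡⟨ cong₂ (λ u v → u + b * v) (select-weight q q≤d) (digitwise ls ls≤d) ⟩
        d * bit (isPos q) + b * (d * digits b (map isPos ls))
          ≡⟨ factor d (bit (isPos q)) b (digits b (map isPos ls)) ⟩
        d * (bit (isPos q) + b * digits b (map isPos ls)) ∎
      where
      open ≡-Reasoning
      V : ℕ
      V = numeral b ls
      N' : Fin n → ℕ
      N' k = digits b (map (λ q → select q k) ls)
      S : ℕ
      S = ∑ (λ k → w k * N' k)
      distribute : ∀ x y b z → x * (y + b * z) ≡ x * y + b * (x * z)
      distribute = solve-∀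
      regroup : ∀ q b V W S → (q + b * V) + (W + b * S) ≡ (W + q) + b * (V + S)
      regroup = solve-∀
      factor : ∀ d x b y → d * x + b * (d * y) ≡ d * (x + b * y)
      factor = solve-∀
      split : ∑ (λ k → w k * (bit (select q k) + b * N' k)) ≡ Wt w (select q) + b * S
      split = trans (∑-cong (λ k → distribute (w k) (bit (select q k)) b (N' k)))
        (trans (∑-+ (λ k → w k * bit (select q k)) (λ k → b * (w k * N' k)))
               (cong (Wt w (select q) +_) (∑-* b (λ k → w k * N' k))))

    -- N_M < Q because the digit q₀ ≥ 2 of Q becomes 1, and Nₖ ≤ N_M digitwise.
    NM<Q : NM < Q
    NM<Q = begin-strict
        NM                                   ≡⟨ digits-numeral b isPos qs ⟩
        numeral b (map (bit ∘ isPos) qs)     <⟨ numeral-strict b (bit ∘ isPos) (λ q → q) bit-isPos≤ qs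
                                                  (Any.map (λ { refl → ≤-trans (s≤s (bit≤1 (isPos q₀))) 2≤q₀ }) q₀∈qs) ⟩
        numeral b (map (λ q → q) qs)         ≡⟨ cong (numeral b) (map-id qs) ⟩
        numeral b qs                         ≡⟨ Q≡ ⟩
        Q                                    ∎
      where
      open ≤-Reasoning

    Nk≤NM : ∀ k → Nk k ≤ NM
    Nk≤NM k = begin
        Nk k                                        ≡⟨ digits-numeral b (λ q → select q k) qs ⟩
        numeral b (map (λ q → bit (select q k)) qs) ≤⟨ numeral-mono b _ _ digit≤ qs ⟩
        numeral b (map (bit ∘ isPos) qs)            ≡⟨ sym (digits-numeral b isPos qs) ⟩
        NM                                          ∎
      where
      open ≤-Reasoning
      digit≤ : ∀ q → bit (select q k) ≤ bit (isPos q)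
      digit≤ zero = ≤-reflexive (cong bit (select-0 k))
      digit≤ (suc q) = bit≤1 (select (suc q) k)

    xs : Fin (suc n) → ℕ
    xs fzero = x
    xs (fsuc k) = c * Nk k + r k

    y : ℕ
    y = c * NM + rm

    xk<x : ∀ k → xs (fsuc k) < x
    xk<x k = subst (xs (fsuc k) <_) (sym x≡) (c·N+r< (≤-<-trans (Nk≤NM k) NM<Q) (R<c (r∈R k)))

    y<x : y < x
    y<x = subst (y <_) (sym x≡) (c·N+r< NM<Q (R<c rm∈R))

    -- Distinctness: on H ∪ {m} and on its complement by (ii); between the two
    -- sides, the numerals differ in the digit at q₀.
    numerals-differ : ∀ (f g : ℕ → Bool) → f q₀ ≢ g q₀ → digits b (map f qs) ≢ digits b (map g qs)
    numerals-differ f g f≢g = digits-distinct b (s≤s 1≤d) f g qs (Any.map (λ { refl → f≢g }) q₀∈qs)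

    tail-distinct : ∀ k k' → k ≢ k' → xs (fsuc k) ≢ xs (fsuc k')
    tail-distinct k k' k≢k' eq with c·N+r-injective _ _ _ _ (R<c (r∈R k)) (R<c (r∈R k')) eq
    ... | Nk≡ , r≡ with H k Bool.≟ H k'
    ...   | no H≢ = numerals-differ (λ q → select q k) (λ q → select q k')
                       (λ e → H≢ (trans (sym (select-q₀ k)) (trans e (select-q₀ k')))) Nk≡
    ...   | yes H≡ with H k in Hk
    ...     | true = distinct-in k k' Hk (sym H≡) k≢k' r≡
    ...     | false = distinct-out k k' Hk (sym H≡) k≢k' r≡

    tail≢y : ∀ k → xs (fsuc k) ≢ y
    tail≢y k eq with c·N+r-injective _ _ _ _ (R<c (r∈R k)) (R<c rm∈R) eq
    ... | Nk≡NM , r≡rm with H k in Hk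
    ...   | true = distinct-rm k Hk r≡rm
    ...   | false = numerals-differ (λ q → select q k) isPos differ-at-q₀ Nk≡NM
      where
      isPos-q₀ : ∀ {q} → 2 ≤ q → isPos q ≡ true
      isPos-q₀ (s≤s _) = refl
      differ-at-q₀ : select q₀ k ≢ isPos q₀
      differ-at-q₀ e with trans (sym (trans (select-q₀ k) Hk)) (trans e (isPos-q₀ 2≤q₀))
      ... | ()

    xs-distinct : Distinct xs
    xs-distinct fzero fzero 0≢0 _ = 0≢0 refl
    xs-distinct fzero (fsuc k) _ e = <⇒≢ (xk<x k) (sym e)
    xs-distinct (fsuc k) fzero _ e = <⇒≢ (xk<x k) e
    xs-distinct (fsuc k) (fsuc k') k≢k' = tail-distinct k k' (k≢k' ∘ cong fsuc)

    xs≢y : ∀ i → xs i ≢ y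
    xs≢y fzero e = <⇒≢ y<x (sym e)
    xs≢y (fsuc k) = tail≢y k

    balance : ∑ (λ i → D i * xs i) ≡ d * y
    balance = begin
        D fzero * x + ∑ (λ k → w k * (c * Nk k + r k))
          ≡⟨ cong₂ _+_ (cong (D fzero *_) x≡) split ⟩
        D fzero * (c * Q + r1) + (c * SN + SR)
          ≡⟨ cong (_+ (c * SN + SR)) first-term ⟩
        (c * Q + D fzero * r1) + (c * SN + SR)
          ≡⟨ regroup c Q (D fzero * r1) SN SR ⟩
        c * (Q + SN) + (D fzero * r1 + SR)
          ≡⟨ cong₂ (λ u v → c * u + v) (trans (cong (_+ SN) (sym Q≡)) (digitwise qs qs≤d)) equation ⟩
        c * (d * NM) + d * rm
          ≡⟨ factor c d NM rm ⟩
        d * y ∎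
      where
      open ≡-Reasoning
      SN SR : ℕ
      SN = ∑ (λ k → w k * Nk k)
      SR = ∑ (λ k → w k * r k)
      distribute : ∀ D c N r → D * (c * N + r) ≡ c * (D * N) + D * r
      distribute = solve-∀
      regroup : ∀ c Q u SN SR → (c * Q + u) + (c * SN + SR) ≡ c * (Q + SN) + (u + SR)
      regroup = solve-∀
      factor : ∀ c d N r → c * (d * N) + d * r ≡ d * (c * N + r)
      factor = solve-∀
      split : ∑ (λ k → w k * (c * Nk k + r k)) ≡ c * SN + SR
      split = trans (∑-cong (λ k → distribute (w k) c (Nk k) (r k)))
        (trans (∑-+ (λ k → c * (w k * Nk k)) (λ k → w k * r k)) (cong (_+ SR) (∑-* c (λ k → w k * Nk k))))
      first-term : D fzero * (c * Q + r1) ≡ c * Q + D fzero * r1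
      first-term = trans (*-distribˡ-+ (D fzero) (c * Q) r1)
        (cong (_+ D fzero * r1) (trans (cong (_* (c * Q)) (Valid.first valid)) (+-identityʳ (c * Q))))

    xs∈P : ∀ i → P (xs i)
    xs∈P fzero = x∈P
    xs∈P (fsuc k) = T<x⊆P _ (tk k , r k , r∈R k , refl) (xk<x k)

    solution : HasSol D P
    solution = xs , y , xs∈P , T<x⊆P y (tM , rm , rm∈R , refl) y<x , xs-distinct , xs≢y , balance

  -- A number x = c·N + r₁ with r₁ ∉ R forces a solution in any set P containing x
  -- and all elements of T below x: r₁ lies in a gap a j < r₁ < a (j + 1) with j ≤ z,
  -- greediness gives a solution in {a 0, …, a j, r₁}, and we translate it by c·N.
  foreign-remainder : ∀ x r1 t → x ≡ c * digits b t + r1 →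
    (Σ ℕ λ j → j ≤ z × a j < r1 × r1 < a (suc j)) →
    (P : ℕ → Set) → P x → (∀ v → T v → v < x → P v) → HasSol D P
  foreign-remainder x r1 t x≡ (j , j≤z , aj<r1 , r1<aj+1) P x∈P T<x⊆P =
    HasSol-mono D into-P (HasSol-shift D K (IsS.least isS j r1 aj<r1 r1<aj+1))
    where
    K : ℕ
    K = c * digits b t
    into-P : ∀ v → (Σ ℕ λ u → (Prefix a j u ⊎ u ≡ r1) × v ≡ K + u) → P v
    into-P _ (_ , inj₁ (i , i≤j , refl) , refl) =
      T<x⊆P _ (t , a i , (i , ≤-trans i≤j j≤z , refl) , refl)
        (subst (K + a i <_) (sym x≡) (+-monoʳ-< K (≤-<-trans (a-mono i≤j) aj<r1)))
    into-P _ (_ , inj₂ refl , refl) = subst P x≡ x∈P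

  Invariant : ℕ → Set
  Invariant k = (∀ i → i ≤ k → T (a i)) × (∀ v → T v → v ≤ a k → Prefix a k v)

  invariant-zero : Invariant 0
  invariant-zero = a₀∈T , below-a₀
    where
    a₀∈T : ∀ i → i ≤ 0 → T (a i)
    a₀∈T zero _ =
      [] , 0 , (0 , z≤n , IsS.start isS) , trans (IsS.start isS) (sym (trans (+-identityʳ (c * 0)) (*-zeroʳ c)))
    below-a₀ : ∀ v → T v → v ≤ a 0 → Prefix a 0 v
    below-a₀ v _ v≤a₀ = 0 , z≤n , trans (IsS.start isS) (sym (n≤0⇒n≡0 (subst (v ≤_) (IsS.start isS) v≤a₀)))

  -- No element of T lies strictly between a k and a (k + 1): with a 0, …, a k ∈ T
  -- the greedy choice would give a solution in T.
  closure-step : ∀ k → Invariant k → ∀ v → T v → v ≤ a (suc k) → Prefix a (suc k) v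
  closure-step k (prefix∈T , closed) v v∈T v≤a' with v ≤? a k
  ... | yes v≤a = prefix-weaken (n≤1+n k) (closed v v∈T v≤a)
  ... | no v≰a with v ≟ a (suc k)
  ...   | yes v≡a' = suc k , ≤-refl , sym v≡a'
  ...   | no v≢a' = ⊥-elim (T-free (HasSol-mono D into-T (IsS.least isS k v (≰⇒> v≰a) (≤∧≢⇒< v≤a' v≢a'))))
    where
    into-T : ∀ u → Prefix a k u ⊎ u ≡ v → T u
    into-T _ (inj₁ (i , i≤k , refl)) = prefix∈T i i≤k
    into-T _ (inj₂ refl) = v∈T

  -- a (k + 1) ∈ T: write it as c·Q + r₁ with r₁ < c.  A digit ≥ 2 of Q, or r₁ ∉ R,
  -- would give a solution in {a 0, …, a (k + 1)}.
  module MembershipStep (k : ℕ) (T<x⊆P : ∀ v → T v → v < a (suc k) → Prefix a (suc k) v) where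

    x : ℕ
    x = a (suc k)

    P-free : ¬ HasSol D (Prefix a (suc k))
    P-free = IsS.free isS k

    x∈P : Prefix a (suc k) x
    x∈P = suc k , ≤-refl , refl

    instance
      c≢0 : NonZero c
      c≢0 = >-nonZero (≤-<-trans z≤n M<c)

    Q r1 : ℕ
    Q = x / c
    r1 = x % c

    x≡ : x ≡ c * Q + r1
    x≡ = trans (m≡m%n+[m/n]*n x c) (trans (+-comm r1 (Q * c)) (cong (_+ r1) (*-comm Q c)))

    expansion : Σ (List ℕ) λ qs → All (_≤ d) qs × numeral b qs ≡ Q
    expansion = base-expansion d 1≤d Q

    qs : List ℕ
    qs = proj₁ expansion

    binary : All (_≤ 1) qs
    binary with All.all? (_≤? 1) qs
    ... | yes small = small
    ... | no large with find (¬All⇒Any¬ (_≤? 1) qs large)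
    ...   | q₀ , q₀∈qs , q₀≰1 = ⊥-elim (P-free (LargeDigit.solution x r1 Q (m%n<n x c) x≡
              qs (proj₁ (proj₂ expansion)) (proj₂ (proj₂ expansion)) q₀ q₀∈qs (≰⇒> q₀≰1)
              (Prefix a (suc k)) x∈P T<x⊆P))

    x≡c·N+r1 : x ≡ c * digits b (map isPos qs) + r1
    x≡c·N+r1 = trans x≡ (cong (λ N → c * N + r1) (sym (trans (digits-isPos b qs binary) (proj₂ (proj₂ expansion)))))

    x∈T : T x
    x∈T with locate z r1 (m%n<n x c)
    ... | inj₁ r1∈R = map isPos qs , r1 , r1∈R , x≡c·N+r1
    ... | inj₂ gap =
      ⊥-elim (P-free (foreign-remainder x r1 (map isPos qs) x≡c·N+r1 gap (Prefix a (suc k)) x∈P T<x⊆P))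

  invariant : ∀ k → Invariant k
  invariant zero = invariant-zero
  invariant (suc k) = prefix∈T , closed
    where
    previous : Invariant k
    previous = invariant k
    closed : ∀ v → T v → v ≤ a (suc k) → Prefix a (suc k) v
    closed = closure-step k previous
    prefix∈T : ∀ i → i ≤ suc k → T (a i)
    prefix∈T i i≤1+k with i ≟ suc k
    ... | yes refl = MembershipStep.x∈T k (λ v v∈T v<x → closed v v∈T (<⇒≤ v<x))
    ... | no i≢1+k = proj₁ previous i (≤-pred (≤∧≢⇒< i≤1+k i≢1+k))

theorem3 : (n : ℕ) (D : Tuple n) → Nondecreasing D → Valid D →
  (a : ℕ → ℕ) → IsS D a →
  (z : ℕ) → 0 < z →
  a (suc z) + ∑ (λ (i : Fin n) → D (fsuc i) * (n ∸ suc (toℕ i))) ≡ 1 + dsum D * a z →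
  (∀ r1 → r1 < a (suc z) → ∀ j → j + 2 ≤ dsum D →
    Σ (Fin n → Bool) λ H → Σ (Fin n → ℕ) λ r → Σ ℕ λ rm →
      (∀ i → Prefix a z (r i)) × Prefix a z rm ×
      (∑ (λ i → if H i then D (fsuc i) else 0) ≡ j) ×
      (D fzero * r1 + ∑ (λ i → D (fsuc i) * r i) ≡ dsum D * rm) ×
      (∀ i i' → H i ≡ true → H i' ≡ true → i ≢ i' → r i ≢ r i') ×
      (∀ i → H i ≡ true → r i ≢ rm) ×
      (∀ i i' → H i ≡ false → H i' ≡ false → i ≢ i' → r i ≢ r i')) →
  ∀ k → Σ (List Bool) λ t → Σ ℕ λ r →
    Prefix a z r × a k ≡ a (suc z) * digits (suc (dsum D)) t + r
theorem3 n D nd valid a isS z 0<z c-formula covering k = proj₁ (invariant k) k ≤-refl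
  where open Main n D nd valid a isS z 0<z c-formula covering using (invariant)
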